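{- Let $(X,\le,D,\top,\tau)$ be a bRS-space. Then $(X,\le,\le\cup\ge,D,\top,\tau)$ is a Sugihara space.
   Context: A Priestley space $(X,\le,\tau)$ is a compact space with a partial order such that $x\not\le y$ implies some clopen up-set contains $x$ but not $y$; it is Esakia if $\downarrow U$ is clopen for every clopen $U$; pointed if it has a greatest element $\top$. A forest is a poset in which ${\uparrow}x$ is a chain for every $x$. A bRS-space is $(X,\le,D,\top,\tau)$ with $(X,\le,\top,\tau)$ a pointed Esakia space, $(X,\le)$ a forest, and $D$ a clopen set of $\le$-minimal elements. A pointed Kleene space is $(X,\le,Q,D,\top,\tau)$ with $(X,\le,\top,\tau)$ a pointed Priestley space, $Q$ a closed binary relation, $D$ closed, and for all $x,y,z$: $xQx$; ($xQy$ and $x\in D$) implies $x\le y$; ($xQy$ and $y\le z$) implies $zQx$. A Sugihara space is a pointed Kleene space with $(X,\le,\top,\tau)$ pointed Esakia, $Q=\le\cup\ge$, and $D$ open. -}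

module Defs where

open import Data.Product using (Σ; _×_; _,_)
open import Data.Sum using (_⊎_)
open import Data.Unit using (⊤)
open import Data.List using (List)
open import Data.List.Relation.Unary.Any using (Any)
open import Relation.Nullary using (¬_)
open import Relation.Binary.PropositionalEquality using (_≡_)
open import Relation.Binary.Structures using (IsPartialOrder)

Subset : Set → Set₁
Subset X = X → Set

Rel₂ : Set → Set₁
Rel₂ X = X → X → Set

∁ : {X : Set} → Subset X → Subset X
∁ U x = ¬ U x

record Topology (X : Set) : Set₁ where
  field
    IsOpen   : Subset X → Set
    -- openness is a property of the subset (extensional)
    open-ext : (U V : Subset X) → (∀ x → U x → V x) → (∀ x → V x → U x) →
               IsOpen U → IsOpen V
    open-univ : IsOpen (λ _ → ⊤)
    open-∩   : (U V : Subset X) → IsOpen U → IsOpen V →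
               IsOpen (λ x → U x × V x)
    open-⋃   : (I : Set) (F : I → Subset X) → (∀ i → IsOpen (F i)) →
               IsOpen (λ x → Σ I (λ i → F i x))

module _ {X : Set} (τ : Topology X) where
  open Topology τ

  IsClosed : Subset X → Set
  IsClosed U = IsOpen (∁ U)

  IsClopen : Subset X → Set
  IsClopen U = IsOpen U × IsClosed U

  IsCompact : Set₁
  IsCompact = (I : Set) (F : I → Subset X) → (∀ i → IsOpen (F i)) →
              (∀ x → Σ I (λ i → F i x)) →
              Σ (List I) (λ is → ∀ x → Any (λ i → F i x) is)

  -- open subsets of X × X in the product topology: unions of open boxes
  IsOpen² : Rel₂ X → Set₁
  IsOpen² R = ∀ x y → R x y →
              Σ (Subset X) (λ U → Σ (Subset X) (λ V →
                IsOpen U × IsOpen V × U x × V y ×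
                (∀ x' y' → U x' → V y' → R x' y')))

  IsClosedRel : Rel₂ X → Set₁
  IsClosedRel R = IsOpen² (λ x y → ¬ R x y)

module _ {X : Set} (_≤_ : Rel₂ X) where

  IsUpSet : Subset X → Set
  IsUpSet U = ∀ x y → U x → x ≤ y → U y

  ↓ : Subset X → Subset X
  ↓ U x = Σ X (λ y → U y × x ≤ y)

  IsGreatest : X → Set
  IsGreatest t = ∀ x → x ≤ t

  IsMinimal : X → Set
  IsMinimal x = ∀ y → y ≤ x → y ≡ x

  IsForest : Set
  IsForest = ∀ x y z → x ≤ y → x ≤ z → (y ≤ z) ⊎ (z ≤ y)

record IsPriestley {X : Set} (_≤_ : Rel₂ X) (τ : Topology X) : Set₁ where
  field
    compact    : IsCompact τ
    partial    : IsPartialOrder _≡_ _≤_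
    separation : ∀ x y → ¬ (x ≤ y) →
                 Σ (Subset X) (λ U → IsClopen τ U × IsUpSet _≤_ U × U x × ¬ U y)

record IsEsakia {X : Set} (_≤_ : Rel₂ X) (τ : Topology X) : Set₁ where
  field
    priestley : IsPriestley _≤_ τ
    ↓-clopen  : ∀ U → IsClopen τ U → IsClopen τ (↓ _≤_ U)

record IsPointedPriestley {X : Set} (_≤_ : Rel₂ X) (top : X) (τ : Topology X) : Set₁ where
  field
    priestley : IsPriestley _≤_ τ
    greatest  : IsGreatest _≤_ top

record IsPointedEsakia {X : Set} (_≤_ : Rel₂ X) (top : X) (τ : Topology X) : Set₁ where
  field
    esakia   : IsEsakia _≤_ τ
    greatest : IsGreatest _≤_ top

record IsBRS {X : Set} (_≤_ : Rel₂ X) (D : Subset X) (top : X) (τ : Topology X) : Set₁ where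
  field
    pointedEsakia : IsPointedEsakia _≤_ top τ
    forest        : IsForest _≤_
    D-clopen      : IsClopen τ D
    D-minimal     : ∀ x → D x → IsMinimal _≤_ x

record IsPointedKleene {X : Set} (_≤_ : Rel₂ X) (Q : Rel₂ X) (D : Subset X) (top : X)
                       (τ : Topology X) : Set₁ where
  field
    pointedPriestley : IsPointedPriestley _≤_ top τ
    Q-closed         : IsClosedRel τ Q
    D-closed         : IsClosed τ D
    Q-refl           : ∀ x → Q x x
    Q-D              : ∀ x y → Q x y → D x → x ≤ y
    Q-≤              : ∀ x y z → Q x y → y ≤ z → Q z x

record IsSugihara {X : Set} (_≤_ : Rel₂ X) (Q : Rel₂ X) (D : Subset X) (top : X)
                  (τ : Topology X) : Set₁ where
  field
    pointedKleene : IsPointedKleene _≤_ Q D top τ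
    pointedEsakia : IsPointedEsakia _≤_ top τ
    Q-≤∪≥         : ∀ x y → (Q x y → (x ≤ y) ⊎ (y ≤ x)) × ((x ≤ y) ⊎ (y ≤ x) → Q x y)
    D-open        : Topology.IsOpen τ D

≤∪≥ : {X : Set} → Rel₂ X → Rel₂ X
≤∪≥ _≤_ x y = (x ≤ y) ⊎ (y ≤ x)

module Submission where

-- Most of the Sugihara axioms are inherited verbatim from the bRS data
-- (the pointed Esakia structure, and D being clopen gives both D closed
-- and D open).  The content lies in three facts about Q = ≤ ∪ ≥, each
-- proved below at its natural generality:
--   * in any Priestley space, ≤ ∪ ≥ is a closed subset of X × X
--     (Priestley separation in both directions yields an open box around
--     any incomparable pair);
--   * in any forest, (x ≤ y or y ≤ x) and y ≤ z imply z and x are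
--     comparable, since ↑y (resp. ↑x) is a chain;
--   * for a minimal element x, comparability with y forces x ≤ y.

open import Defs
open import Data.Product using (_×_; _,_; proj₁; proj₂)
open import Data.Sum using (inj₁; inj₂)
open import Relation.Nullary using (¬_)
open import Relation.Binary.PropositionalEquality using (_≡_; sym)
open import Relation.Binary.Structures using (IsPartialOrder)

-- In a Priestley space the comparability relation ≤ ∪ ≥ is closed: if x
-- and y are incomparable, a clopen up-set U ∋ x missing y and a clopen
-- up-set V ∋ y missing x give the open box (U ∖ V) × (V ∖ U) of
-- incomparable pairs around (x , y).
comparability-closed : {X : Set} {_≤_ : Rel₂ X} {τ : Topology X} →
                       IsPriestley _≤_ τ → IsClosedRel τ (≤∪≥ _≤_)
comparability-closed {_≤_ = _≤_} {τ} priestley x y incomparable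
  with separation x y (λ x≤y → incomparable (inj₁ x≤y))
     | separation y x (λ y≤x → incomparable (inj₂ y≤x))
  where open IsPriestley priestley
... | U , (U-open , U-closed) , U-up , Ux , ¬Uy
    | V , (V-open , V-closed) , V-up , Vy , ¬Vx =
  (λ a → U a × ¬ V a) , (λ b → V b × ¬ U b) ,
  open-∩ U (∁ V) U-open V-closed , open-∩ V (∁ U) V-open U-closed ,
  (Ux , ¬Vx) , (Vy , ¬Uy) , box-incomparable
  where
  open Topology τ

  box-incomparable : ∀ a b → U a × ¬ V a → V b × ¬ U b → ¬ ≤∪≥ _≤_ a b
  box-incomparable a b (Ua , _) (_ , ¬Ub) (inj₁ a≤b) = ¬Ub (U-up a b Ua a≤b)
  box-incomparable a b (_ , ¬Va) (Vb , _) (inj₂ b≤a) = ¬Va (V-up b a Vb b≤a)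

forest-comparable-upward : {X : Set} {_≤_ : Rel₂ X} →
                           (∀ {a b c} → a ≤ b → b ≤ c → a ≤ c) →
                           IsForest _≤_ →
                           ∀ x y z → ≤∪≥ _≤_ x y → y ≤ z → ≤∪≥ _≤_ z x
forest-comparable-upward trans forest x y z (inj₁ x≤y) y≤z = inj₂ (trans x≤y y≤z)
forest-comparable-upward trans forest x y z (inj₂ y≤x) y≤z
  with forest y x z y≤x y≤z
... | inj₁ x≤z = inj₂ x≤z
... | inj₂ z≤x = inj₁ z≤x

minimal-comparable⇒≤ : {X : Set} {_≤_ : Rel₂ X} →
                       (∀ {a b} → a ≡ b → a ≤ b) →
                       ∀ x y → IsMinimal _≤_ x → ≤∪≥ _≤_ x y → x ≤ y
minimal-comparable⇒≤ reflexive x y minimal (inj₁ x≤y) = x≤y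
minimal-comparable⇒≤ reflexive x y minimal (inj₂ y≤x) =
  reflexive (sym (minimal y y≤x))

mainTheorem13 : {X : Set} (_≤_ : Rel₂ X) (D : Subset X) (top : X) (τ : Topology X) →
    IsBRS _≤_ D top τ → IsSugihara _≤_ (≤∪≥ _≤_) D top τ
mainTheorem13 _≤_ D top τ brs = record
  { pointedKleene = record
    { pointedPriestley = record { priestley = priestley ; greatest = greatest }
    ; Q-closed = comparability-closed priestley
    ; D-closed = proj₂ D-clopen
    ; Q-refl   = λ x → inj₁ refl
    ; Q-D      = λ x y x≷y Dx → minimal-comparable⇒≤ reflexive x y (D-minimal x Dx) x≷y
    ; Q-≤      = forest-comparable-upward trans forest
    }
  ; pointedEsakia = pointedEsakia
  ; Q-≤∪≥  = λ x y → (λ x≷y → x≷y) , (λ x≷y → x≷y)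
  ; D-open = proj₁ D-clopen
  }
  where
  open IsBRS brs
  open IsPointedEsakia pointedEsakia using (esakia; greatest)
  priestley : IsPriestley _≤_ τ
  priestley = IsEsakia.priestley esakia
  open IsPartialOrder (IsPriestley.partial priestley) using (refl; reflexive; trans)
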